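{- Any constant-error randomized communication protocol that computes a proper $(\Delta+1)$-coloring of $n$-vertex graphs in the two-party edge-partition model requires $\Omega(n)$ bits of communication in the worst case.
   Context: Two-party edge-partition model: the input is an undirected graph $G=(V,E)$ on vertex set $[n]$ with maximum degree $\Delta$; $E$ is partitioned into disjoint sets $E_A$ (Alice's) and $E_B$ (Bob's); both know $n$ and $\Delta$. At the end both players must agree on a coloring $C\in[\Delta+1]^n$, which must be proper ($C(u)\ne C(v)$ for every edge $\{u,v\}\in E$) with probability at least a constant bounded away from the trivial; constant-error means the protocol errs with probability at most some constant $\varepsilon<1/2$ on every input. -}

module Defs where

open import Data.Nat using (ℕ; zero; suc; _+_; _*_; _≤_; _⊔_)
open import Data.Bool using (Bool; true; false; if_then_else_; _∧_; _∨_; not)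
open import Data.Fin using (Fin; zero; suc; _≟_)
open import Data.Vec using (Vec; []; _∷_)
open import Data.Product using (_×_)
open import Relation.Binary.PropositionalEquality using (_≡_)
open import Relation.Nullary.Decidable using (⌊_⌋)
open import Function using (_∘_)

countFin : ∀ {n} → (Fin n → Bool) → ℕ
countFin {zero}  f = 0
countFin {suc n} f = (if f zero then 1 else 0) + countFin (f ∘ suc)

allFin : ∀ {n} → (Fin n → Bool) → Bool
allFin {zero}  f = true
allFin {suc n} f = f zero ∧ allFin (f ∘ suc)

countStrings : ∀ r → (Vec Bool r → Bool) → ℕ
countStrings zero    f = if f [] then 1 else 0
countStrings (suc r) f = countStrings r (λ s → f (true ∷ s)) + countStrings r (λ s → f (false ∷ s))

maxStrings : ∀ r → (Vec Bool r → ℕ) → ℕ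
maxStrings zero    g = g []
maxStrings (suc r) g = maxStrings r (λ s → g (true ∷ s)) ⊔ maxStrings r (λ s → g (false ∷ s))

Graph : ℕ → Set
Graph n = Fin n → Fin n → Bool

_∪G_ : ∀ {n} → Graph n → Graph n → Graph n
(A ∪G B) u v = A u v ∨ B u v

Symmetric : ∀ {n} → Graph n → Set
Symmetric E = ∀ u v → E u v ≡ E v u

Irreflexive : ∀ {n} → Graph n → Set
Irreflexive E = ∀ u → E u u ≡ false

Disjoint : ∀ {n} → Graph n → Graph n → Set
Disjoint A B = ∀ u v → (A u v ∧ B u v) ≡ false

degree : ∀ {n} → Graph n → Fin n → ℕ
degree E u = countFin (E u)

MaxDegreeAtMost : ∀ {n} → ℕ → Graph n → Set
MaxDegreeAtMost Δ E = ∀ u → degree E u ≤ Δ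

-- A valid input of the two-party edge-partition model: Alice holds E_A,
-- Bob holds E_B, these are disjoint edge sets of simple undirected graphs
-- and G = ([n], E_A ∪ E_B) has maximum degree (at most) Δ.
ValidInput : (n Δ : ℕ) → Graph n → Graph n → Set
ValidInput n Δ EA EB =
  Symmetric EA × Symmetric EB × Irreflexive EA × Irreflexive EB ×
  Disjoint EA EB × MaxDegreeAtMost Δ (EA ∪G EB)

Coloring : ℕ → ℕ → Set
Coloring n Δ = Fin n → Fin (suc Δ)

isProper : ∀ {n Δ} → Graph n → Coloring n Δ → Bool
isProper E C = allFin λ u → allFin λ v → not (E u v) ∨ not ⌊ C u ≟ C v ⌋

-- Each internal node
-- is owned by one player, who sends one bit depending on its own input;
-- a leaf is labelled with the common output (both players know it).

data Protocol (X Y O : Set) : Set where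
  leaf  : O → Protocol X Y O
  alice : (X → Bool) → Protocol X Y O → Protocol X Y O → Protocol X Y O
  bob   : (Y → Bool) → Protocol X Y O → Protocol X Y O → Protocol X Y O

run : ∀ {X Y O} → Protocol X Y O → X → Y → O
run (leaf o)      x y = o
run (alice f p q) x y = if f x then run p x y else run q x y
run (bob g p q)   x y = if g y then run p x y else run q x y

-- worst-case number of bits communicated (depth of the tree)
depth : ∀ {X Y O} → Protocol X Y O → ℕ
depth (leaf _)      = 0
depth (alice _ p q) = suc (depth p ⊔ depth q)
depth (bob _ p q)   = suc (depth p ⊔ depth q)

-- Randomized (public-coin) protocols using r uniformly random bits:
-- a distribution over deterministic protocols indexed by the coin string.

RProtocol : ℕ → Set → Set → Set → Set
RProtocol r X Y O = Vec Bool r → Protocol X Y O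

cost : ∀ {r X Y O} → RProtocol r X Y O → ℕ
cost {r} Π = maxStrings r (λ s → depth (Π s))

ColoringProtocol : ℕ → ℕ → ℕ → Set
ColoringProtocol r n Δ = RProtocol r (Graph n) (Graph n) (Coloring n Δ)

failures : ∀ {r n Δ} → ColoringProtocol r n Δ → Graph n → Graph n → ℕ
failures {r} Π EA EB =
  countStrings r (λ s → not (isProper (EA ∪G EB) (run (Π s) EA EB)))

-- Π computes a proper (Δ+1)-coloring with error probability at most p/q
-- on every valid input:  #failures / 2^r ≤ p / q.
ComputesColoringWithError : ∀ {r n Δ} → ℕ → ℕ → ColoringProtocol r n Δ → Set
ComputesColoringWithError {r} {n} {Δ} p q Π =
  ∀ EA EB → ValidInput n Δ EA EB → q * failures Π EA EB ≤ p * (2 Data.Nat.^ r)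

-- Take Δ = 2 and give Alice no edges. Bob holds a graph made of ⌊n/4⌋ disjoint
-- 4-vertex gadgets, each being one of two 4-cycles whose union is K₄; which one
-- is chosen by one bit of w ∈ {0,1}^m. K₄ is not 3-colourable, so a colouring
-- is proper for at most one of these 2^m graphs. A deterministic protocol of
-- depth D has at most 2^D leaves, so it succeeds on at most 2^D inputs. A
-- randomized protocol with error below 1/2 succeeds on more than half of all
-- (input, coin) pairs, and counting those pairs coin by coin gives
-- 2^m < 2^(D+1), i.e. D ≥ ⌊n/4⌋.
module Submission where

open import Defs
open import Data.Bool using (Bool; true; false; if_then_else_; not; _∧_; _∨_; _xor_)
open import Data.Bool.Properties using (xor-comm; xor-same; ¬-not)
import Data.Bool.Properties as Bool
open import Data.Empty using (⊥; ⊥-elim)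
open import Data.Fin using (Fin; zero; suc; toℕ; splitAt; _↑ˡ_; _↑ʳ_; _≟_)
open import Data.Fin.Properties using (all?; pigeonhole; <⇒≢; splitAt-↑ˡ; splitAt-↑ʳ)
open import Data.Nat using (ℕ; zero; suc; _+_; _*_; _^_; _⊔_; _≤_; _<_; _≤?_; _<ᵇ_; _≡ᵇ_; z≤n; s≤s; z<s; >-nonZero)
open import Data.Nat.DivMod using (_/_; _%_; m%n<n; m≡m%n+[m/n]*n; m/n*n≤m; m≥n⇒m/n>0)
open import Data.Nat.Properties hiding (_≟_; <⇒≢)
open import Algebra.Properties.CommutativeSemigroup +-commutativeSemigroup using (interchange)
open import Data.Product using (∃; _×_; _,_; proj₁; proj₂)
open import Data.Sum using (_⊎_; inj₁; inj₂; map₁)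
open import Data.Vec using (Vec; []; _∷_)
open import Data.Vec.Properties using (∷-injectiveˡ; ∷-injectiveʳ)
open import Function using (_∘_)
open import Relation.Binary.PropositionalEquality
open import Relation.Nullary using (contradiction; yes; no)
open import Relation.Nullary.Decidable using (⌊_⌋; from-yes; _⊎-dec_)

sumStrings : ∀ r → (Vec Bool r → ℕ) → ℕ
sumStrings zero    f = f []
sumStrings (suc r) f = sumStrings r (λ s → f (true ∷ s)) + sumStrings r (λ s → f (false ∷ s))

sumStrings-mono-≤ : ∀ r {f g : Vec Bool r → ℕ} → (∀ s → f s ≤ g s) → sumStrings r f ≤ sumStrings r g
sumStrings-mono-≤ zero    f≤g = f≤g []
sumStrings-mono-≤ (suc r) f≤g =
  +-mono-≤ (sumStrings-mono-≤ r (f≤g ∘ (true ∷_))) (sumStrings-mono-≤ r (f≤g ∘ (false ∷_)))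

sumStrings-mono-< : ∀ r {f g : Vec Bool r → ℕ} → (∀ s → f s < g s) → sumStrings r f < sumStrings r g
sumStrings-mono-< zero    f<g = f<g []
sumStrings-mono-< (suc r) f<g =
  +-mono-< (sumStrings-mono-< r (f<g ∘ (true ∷_))) (sumStrings-mono-< r (f<g ∘ (false ∷_)))

sumStrings-distrib-+ : ∀ r (f g : Vec Bool r → ℕ) →
  sumStrings r (λ s → f s + g s) ≡ sumStrings r f + sumStrings r g
sumStrings-distrib-+ zero    f g = refl
sumStrings-distrib-+ (suc r) f g = trans
  (cong₂ _+_ (sumStrings-distrib-+ r (f ∘ (true ∷_)) (g ∘ (true ∷_)))
             (sumStrings-distrib-+ r (f ∘ (false ∷_)) (g ∘ (false ∷_))))
  (interchange (sumStrings r (f ∘ (true ∷_))) (sumStrings r (g ∘ (true ∷_)))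
               (sumStrings r (f ∘ (false ∷_))) (sumStrings r (g ∘ (false ∷_))))

*-distribˡ-sumStrings : ∀ r c (f : Vec Bool r → ℕ) → c * sumStrings r f ≡ sumStrings r (λ s → c * f s)
*-distribˡ-sumStrings zero    c f = refl
*-distribˡ-sumStrings (suc r) c f = trans
  (*-distribˡ-+ c _ _)
  (cong₂ _+_ (*-distribˡ-sumStrings r c _) (*-distribˡ-sumStrings r c _))

sumStrings-const : ∀ r c → sumStrings r (λ _ → c) ≡ 2 ^ r * c
sumStrings-const zero    c = sym (+-identityʳ c)
sumStrings-const (suc r) c = begin
  sumStrings r (λ _ → c) + sumStrings r (λ _ → c) ≡⟨ cong₂ _+_ (sumStrings-const r c) (sumStrings-const r c) ⟩
  2 ^ r * c + 2 ^ r * c                           ≡⟨ cong (2 ^ r * c +_) (+-identityʳ (2 ^ r * c)) ⟨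
  2 * (2 ^ r * c)                                 ≡⟨ *-assoc 2 (2 ^ r) c ⟨
  2 ^ suc r * c                                   ∎
  where open ≡-Reasoning

countStrings≡sumStrings : ∀ r (f : Vec Bool r → Bool) → countStrings r f ≡ sumStrings r (λ s → if f s then 1 else 0)
countStrings≡sumStrings zero    f = refl
countStrings≡sumStrings (suc r) f = cong₂ _+_ (countStrings≡sumStrings r _) (countStrings≡sumStrings r _)

sumStrings-countStrings-comm : ∀ m r (f : Vec Bool m → Vec Bool r → Bool) →
  sumStrings m (λ w → countStrings r (f w)) ≡ sumStrings r (λ s → countStrings m (λ w → f w s))
sumStrings-countStrings-comm m zero    f = sym (countStrings≡sumStrings m _)
sumStrings-countStrings-comm m (suc r) f = trans
  (sumStrings-distrib-+ m _ _)
  (cong₂ _+_ (sumStrings-countStrings-comm m r _) (sumStrings-countStrings-comm m r _))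

countStrings-not+countStrings : ∀ r (f : Vec Bool r → Bool) →
  countStrings r (λ s → not (f s)) + countStrings r f ≡ 2 ^ r
countStrings-not+countStrings zero    f with f []
... | true  = refl
... | false = refl
countStrings-not+countStrings (suc r) f = begin
  (N₁ + N₀) + (C₁ + C₀) ≡⟨ interchange N₁ N₀ C₁ C₀ ⟩
  (N₁ + C₁) + (N₀ + C₀) ≡⟨ cong₂ _+_ (countStrings-not+countStrings r _) (countStrings-not+countStrings r _) ⟩
  2 ^ r + 2 ^ r         ≡⟨ cong (2 ^ r +_) (+-identityʳ (2 ^ r)) ⟨
  2 ^ suc r             ∎
  where
  open ≡-Reasoning
  N₁ = countStrings r (λ s → not (f (true ∷ s)))
  N₀ = countStrings r (λ s → not (f (false ∷ s)))
  C₁ = countStrings r (λ s → f (true ∷ s))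
  C₀ = countStrings r (λ s → f (false ∷ s))

countStrings-if≤ : ∀ {A : Set} r (g : Vec Bool r → A → Bool) (c : Vec Bool r → Bool) (a b : Vec Bool r → A) →
  countStrings r (λ s → g s (if c s then a s else b s)) ≤ countStrings r (λ s → g s (a s)) + countStrings r (λ s → g s (b s))
countStrings-if≤ zero g c a b with c []
... | true  = m≤m+n _ _
... | false = m≤n+m _ _
countStrings-if≤ (suc r) g c a b = ≤-trans
  (+-mono-≤ (countStrings-if≤ r (g ∘ (true ∷_)) (c ∘ (true ∷_)) (a ∘ (true ∷_)) (b ∘ (true ∷_)))
            (countStrings-if≤ r (g ∘ (false ∷_)) (c ∘ (false ∷_)) (a ∘ (false ∷_)) (b ∘ (false ∷_))))
  (≤-reflexive (interchange (count a true) (count b true) (count a false) (count b false)))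
  where
  count : (Vec Bool (suc r) → _) → Bool → ℕ
  count d x = countStrings r (λ s → g (x ∷ s) (d (x ∷ s)))

countStrings-none : ∀ r {f : Vec Bool r → Bool} → (∀ s → f s ≡ false) → countStrings r f ≡ 0
countStrings-none zero    none rewrite none [] = refl
countStrings-none (suc r) none =
  cong₂ _+_ (countStrings-none r (none ∘ (true ∷_))) (countStrings-none r (none ∘ (false ∷_)))

countStrings-witness : ∀ r (f : Vec Bool r → Bool) → 0 < countStrings r f → ∃ λ s → f s ≡ true
countStrings-witness zero f pos with f [] in f[]
... | true = [] , f[]
countStrings-witness zero f () | false
countStrings-witness (suc r) f pos with countStrings r (λ s → f (true ∷ s)) in c₁
... | suc _ = let s , fs = countStrings-witness r _ (subst (0 <_) (sym c₁) z<s) in true ∷ s , fs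
... | zero  = let s , fs = countStrings-witness r _ pos in false ∷ s , fs

countStrings-≤1 : ∀ r (f : Vec Bool r → Bool) → (∀ s t → f s ≡ true → f t ≡ true → s ≡ t) → countStrings r f ≤ 1
countStrings-≤1 zero f _ with f []
... | true  = ≤-refl
... | false = z≤n
countStrings-≤1 (suc r) f unique with countStrings r (λ s → f (true ∷ s)) in c₁
... | zero  = countStrings-≤1 r _ (λ s t fs ft → ∷-injectiveʳ (unique _ _ fs ft))
... | suc k = begin
  suc k + countStrings r (λ t → f (false ∷ t)) ≡⟨ cong (suc k +_) (countStrings-none r false-half) ⟩
  suc k + 0                                   ≡⟨ +-identityʳ (suc k) ⟩
  suc k                                       ≡⟨ c₁ ⟨
  countStrings r (λ s → f (true ∷ s))         ≤⟨ countStrings-≤1 r _ (λ s t fs ft → ∷-injectiveʳ (unique _ _ fs ft)) ⟩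
  1                                           ∎
  where
  open ≤-Reasoning
  witness = countStrings-witness r _ (subst (0 <_) (sym c₁) z<s)
  false-half : ∀ t → f (false ∷ t) ≡ false
  false-half t = ¬-not λ ft → contradiction
    (∷-injectiveˡ (unique (true ∷ proj₁ witness) (false ∷ t) (proj₂ witness) ft)) λ ()

≤maxStrings : ∀ r (g : Vec Bool r → ℕ) s → g s ≤ maxStrings r g
≤maxStrings zero    g []          = ≤-refl
≤maxStrings (suc r) g (true ∷ s)  = ≤-trans (≤maxStrings r _ s) (m≤m⊔n _ _)
≤maxStrings (suc r) g (false ∷ s) = ≤-trans (≤maxStrings r _ s) (m≤n⊔m _ _)

+-mono-2^[1+⊔] : ∀ a b B {u v} → u ≤ 2 ^ a * B → v ≤ 2 ^ b * B → u + v ≤ 2 ^ suc (a ⊔ b) * B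
+-mono-2^[1+⊔] a b B {u} {v} u≤ v≤ = begin
  u + v                                 ≤⟨ +-mono-≤ u≤ v≤ ⟩
  2 ^ a * B + 2 ^ b * B                 ≤⟨ +-mono-≤ (grow (m≤m⊔n a b)) (grow (m≤n⊔m a b)) ⟩
  2 ^ (a ⊔ b) * B + 2 ^ (a ⊔ b) * B     ≡⟨ cong (2 ^ (a ⊔ b) * B +_) (+-identityʳ _) ⟨
  2 * (2 ^ (a ⊔ b) * B)                 ≡⟨ *-assoc 2 (2 ^ (a ⊔ b)) B ⟨
  2 ^ suc (a ⊔ b) * B                   ∎
  where
  open ≤-Reasoning
  grow : ∀ {c d} → c ≤ d → 2 ^ c * B ≤ 2 ^ d * B
  grow c≤d = *-monoˡ-≤ B (^-monoʳ-≤ 2 c≤d)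

majority : ∀ p q F S → 2 * p < q → 0 < F + S → q * F ≤ p * (F + S) → F + S < 2 * S
majority p q F S 2p<q 0<F+S qF≤ = begin-strict
  F + S       <⟨ +-monoˡ-< S F<S ⟩
  S + S       ≡⟨ cong (S +_) (+-identityʳ S) ⟨
  2 * S       ∎
  where
  open ≤-Reasoning
  2F<F+S : 2 * F < F + S
  2F<F+S = *-cancelˡ-< q (2 * F) (F + S) (begin-strict
    q * (2 * F)       ≡⟨ *-assoc q 2 F ⟨
    (q * 2) * F       ≡⟨ cong (_* F) (*-comm q 2) ⟩
    (2 * q) * F       ≡⟨ *-assoc 2 q F ⟩
    2 * (q * F)       ≤⟨ *-monoʳ-≤ 2 qF≤ ⟩
    2 * (p * (F + S)) ≡⟨ *-assoc 2 p (F + S) ⟨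
    (2 * p) * (F + S) <⟨ *-monoˡ-< (F + S) {{>-nonZero 0<F+S}} 2p<q ⟩
    q * (F + S)       ∎)
  F<S : F < S
  F<S = +-cancelˡ-< F F S (subst (_< F + S) (cong (F +_) (+-identityʳ F)) 2F<F+S)

2^m<2*2^n⇒m≤n : ∀ m n → 2 ^ m < 2 * 2 ^ n → m ≤ n
2^m<2*2^n⇒m≤n m n 2^m<2^[1+n] = ≮⇒≥ λ n<m → <⇒≱ 2^m<2^[1+n] (^-monoʳ-≤ 2 n<m)

module _ {X Y O : Set} (m : ℕ) {B : ℕ} (x : Vec Bool m → X) (y : Vec Bool m → Y) (good : Vec Bool m → O → Bool)
         (good-rare : ∀ o → countStrings m (λ w → good w o) ≤ B) where

  successes≤2^depth*B : ∀ P → countStrings m (λ w → good w (run P (x w) (y w))) ≤ 2 ^ depth P * B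
  successes≤2^depth*B (leaf o)      = ≤-trans (good-rare o) (≤-reflexive (sym (*-identityˡ B)))
  successes≤2^depth*B (alice f P Q) = ≤-trans
    (countStrings-if≤ m good (f ∘ x) (λ w → run P (x w) (y w)) (λ w → run Q (x w) (y w)))
    (+-mono-2^[1+⊔] (depth P) (depth Q) B (successes≤2^depth*B P) (successes≤2^depth*B Q))
  successes≤2^depth*B (bob g P Q)   = ≤-trans
    (countStrings-if≤ m good (g ∘ y) (λ w → run P (x w) (y w)) (λ w → run Q (x w) (y w)))
    (+-mono-2^[1+⊔] (depth P) (depth Q) B (successes≤2^depth*B P) (successes≤2^depth*B Q))

  2^m<2*2^cost*B : ∀ p {q r} → 2 * p < q → (Π : RProtocol r X Y O) →
    (∀ w → q * countStrings r (λ s → not (good w (run (Π s) (x w) (y w)))) ≤ p * 2 ^ r) →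
    2 ^ m < 2 * (2 ^ cost Π * B)
  2^m<2*2^cost*B p {q} {r} 2p<q Π Π-errs = *-cancelʳ-< (2 ^ r) (2 ^ m) _ (begin-strict
    2 ^ m * 2 ^ r                                  ≡⟨ sumStrings-const m (2 ^ r) ⟨
    sumStrings m (λ _ → 2 ^ r)                     <⟨ sumStrings-mono-< m more-than-half ⟩
    sumStrings m (λ w → 2 * successes w)           ≡⟨ *-distribˡ-sumStrings m 2 successes ⟨
    2 * sumStrings m successes                     ≡⟨ cong (2 *_) (sumStrings-countStrings-comm m r _) ⟩
    2 * sumStrings r (λ s → countStrings m (λ w → good w (run (Π s) (x w) (y w))))
                                                   ≤⟨ *-monoʳ-≤ 2 (sumStrings-mono-≤ r per-coin) ⟩
    2 * sumStrings r (λ _ → 2 ^ cost Π * B)        ≡⟨ cong (2 *_) (sumStrings-const r _) ⟩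
    2 * (2 ^ r * (2 ^ cost Π * B))                 ≡⟨ cong (2 *_) (*-comm (2 ^ r) _) ⟩
    2 * ((2 ^ cost Π * B) * 2 ^ r)                 ≡⟨ *-assoc 2 (2 ^ cost Π * B) (2 ^ r) ⟨
    2 * (2 ^ cost Π * B) * 2 ^ r                   ∎)
    where
    open ≤-Reasoning
    successes : Vec Bool m → ℕ
    successes w = countStrings r (λ s → good w (run (Π s) (x w) (y w)))
    more-than-half : ∀ w → 2 ^ r < 2 * successes w
    more-than-half w = subst (_< 2 * successes w) total
      (majority p q failed (successes w) 2p<q
        (subst (0 <_) (sym total) (m^n>0 2 r))
        (subst (λ t → q * failed ≤ p * t) (sym total) (Π-errs w)))
      where
      failed : ℕ
      failed = countStrings r (λ s → not (good w (run (Π s) (x w) (y w))))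
      total : failed + successes w ≡ 2 ^ r
      total = countStrings-not+countStrings r (λ s → good w (run (Π s) (x w) (y w)))
    per-coin : ∀ s → countStrings m (λ w → good w (run (Π s) (x w) (y w))) ≤ 2 ^ cost Π * B
    per-coin s = ≤-trans (successes≤2^depth*B (Π s))
      (*-monoˡ-≤ B (^-monoʳ-≤ 2 (≤maxStrings r (λ s → depth (Π s)) s)))

emptyGraph : ∀ {n} → Graph n
emptyGraph _ _ = false

Proper : ∀ {n} {A : Set} → Graph n → (Fin n → A) → Set
Proper E C = ∀ u v → E u v ≡ true → C u ≢ C v

∧-true : ∀ {x y} → x ∧ y ≡ true → x ≡ true × y ≡ true
∧-true {true} y≡true = refl , y≡true

allFin-true : ∀ {n} (f : Fin n → Bool) → allFin f ≡ true → ∀ i → f i ≡ true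
allFin-true f all-true zero    = proj₁ (∧-true all-true)
allFin-true f all-true (suc i) = allFin-true (f ∘ suc) (proj₂ (∧-true all-true)) i

isProper⇒Proper : ∀ {n Δ} (E : Graph n) (C : Coloring n Δ) → isProper E C ≡ true → Proper E C
isProper⇒Proper E C proper u v uv Cu≡Cv = uv-distinct (allFin-true _ (allFin-true _ proper u) v)
  where
  uv-distinct : (not (E u v) ∨ not ⌊ C u ≟ C v ⌋) ≡ true → ⊥
  uv-distinct rewrite uv with C u ≟ C v
  ... | yes _    = λ ()
  ... | no Cu≢Cv = λ _ → Cu≢Cv Cu≡Cv

countFin-false : ∀ n → countFin {n} (λ _ → false) ≡ 0
countFin-false zero    = refl
countFin-false (suc n) = countFin-false n

countFin-splitAt : ∀ k {n} (g : Fin k ⊎ Fin n → Bool) →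
  countFin (g ∘ splitAt k) ≡ countFin (g ∘ inj₁) + countFin (g ∘ inj₂)
countFin-splitAt zero    g = refl
countFin-splitAt (suc k) g = trans
  (cong ((if g (inj₁ zero) then 1 else 0) +_) (countFin-splitAt k (g ∘ map₁ suc)))
  (sym (+-assoc (if g (inj₁ zero) then 1 else 0) (countFin (g ∘ inj₁ ∘ suc)) (countFin (g ∘ inj₂))))

_⊎ᴱ_ : ∀ {k n} → Graph k → Graph n → Fin k ⊎ Fin n → Fin k ⊎ Fin n → Bool
(A ⊎ᴱ B) (inj₁ i) (inj₁ j) = A i j
(A ⊎ᴱ B) (inj₂ i) (inj₂ j) = B i j
(A ⊎ᴱ B) _        _        = false

infixr 5 _⊕_

_⊕_ : ∀ {k n} → Graph k → Graph n → Graph (k + n)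
_⊕_ {k} A B u v = (A ⊎ᴱ B) (splitAt k u) (splitAt k v)

module _ {k n} {A : Graph k} {B : Graph n} where

  ⊕-symmetric : Symmetric A → Symmetric B → Symmetric (A ⊕ B)
  ⊕-symmetric A-sym B-sym u v = ⊎ᴱ-sym (splitAt k u) (splitAt k v)
    where
    ⊎ᴱ-sym : ∀ s t → (A ⊎ᴱ B) s t ≡ (A ⊎ᴱ B) t s
    ⊎ᴱ-sym (inj₁ i) (inj₁ j) = A-sym i j
    ⊎ᴱ-sym (inj₂ i) (inj₂ j) = B-sym i j
    ⊎ᴱ-sym (inj₁ _) (inj₂ _) = refl
    ⊎ᴱ-sym (inj₂ _) (inj₁ _) = refl

  ⊕-irreflexive : Irreflexive A → Irreflexive B → Irreflexive (A ⊕ B)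
  ⊕-irreflexive A-irr B-irr u = ⊎ᴱ-irr (splitAt k u)
    where
    ⊎ᴱ-irr : ∀ s → (A ⊎ᴱ B) s s ≡ false
    ⊎ᴱ-irr (inj₁ i) = A-irr i
    ⊎ᴱ-irr (inj₂ i) = B-irr i

  ⊕-maxDegree : ∀ {Δ} → MaxDegreeAtMost Δ A → MaxDegreeAtMost Δ B → MaxDegreeAtMost Δ (A ⊕ B)
  ⊕-maxDegree {Δ} A-deg B-deg u =
    subst (_≤ Δ) (sym (countFin-splitAt k ((A ⊎ᴱ B) (splitAt k u)))) (degree-at (splitAt k u))
    where
    degree-at : ∀ s → countFin (λ j → (A ⊎ᴱ B) s (inj₁ j)) + countFin (λ j → (A ⊎ᴱ B) s (inj₂ j)) ≤ Δ
    degree-at (inj₁ i) rewrite countFin-false n | +-identityʳ (degree A i) = A-deg i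
    degree-at (inj₂ i) rewrite countFin-false k = B-deg i

  ⊕-properˡ : ∀ {P : Set} {C : Fin (k + n) → P} → Proper (A ⊕ B) C → Proper A (C ∘ (_↑ˡ n))
  ⊕-properˡ proper i j ij =
    proper (i ↑ˡ n) (j ↑ˡ n) (trans (cong₂ (A ⊎ᴱ B) (splitAt-↑ˡ k i n) (splitAt-↑ˡ k j n)) ij)

  ⊕-properʳ : ∀ {P : Set} {C : Fin (k + n) → P} → Proper (A ⊕ B) C → Proper B (C ∘ (k ↑ʳ_))
  ⊕-properʳ proper i j ij =
    proper (k ↑ʳ i) (k ↑ʳ j) (trans (cong₂ (A ⊎ᴱ B) (splitAt-↑ʳ k n i) (splitAt-↑ʳ k n j)) ij)

-- gadget true is the 4-cycle 0-2-1-3 (sides {0,1} | {2,3}), gadget false the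
-- 4-cycle 0-1-2-3 (sides {0,2} | {1,3}); together they contain every edge of K₄.
side : Bool → Fin 4 → Bool
side true  i = toℕ i <ᵇ 2
side false i = toℕ i % 2 ≡ᵇ 0

gadget : Bool → Graph 4
gadget b i j = side b i xor side b j

gadget-symmetric : ∀ b → Symmetric (gadget b)
gadget-symmetric b i j = xor-comm (side b i) (side b j)

gadget-irreflexive : ∀ b → Irreflexive (gadget b)
gadget-irreflexive b i = xor-same (side b i)

gadget-maxDegree : ∀ b → MaxDegreeAtMost 2 (gadget b)
gadget-maxDegree true  = from-yes (all? λ i → degree (gadget true) i ≤? 2)
gadget-maxDegree false = from-yes (all? λ i → degree (gadget false) i ≤? 2)

gadgets-cover-K₄ : ∀ i j → i ≡ j ⊎ gadget true i j ≡ true ⊎ gadget false i j ≡ true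
gadgets-cover-K₄ = from-yes (all? λ i → all? λ j →
  i ≟ j ⊎-dec gadget true i j Bool.≟ true ⊎-dec gadget false i j Bool.≟ true)

¬proper-for-both-gadgets : ∀ {c : Fin 4 → Fin 3} → Proper (gadget true) c → Proper (gadget false) c → ⊥
¬proper-for-both-gadgets {c} proper-true proper-false with pigeonhole (n<1+n 3) c
... | i , j , i<j , ci≡cj with gadgets-cover-K₄ i j
...   | inj₁ i≡j        = <⇒≢ i<j i≡j
...   | inj₂ (inj₁ ij) = proper-true i j ij ci≡cj
...   | inj₂ (inj₂ ij) = proper-false i j ij ci≡cj

gadget-determined : ∀ {b b'} {c : Fin 4 → Fin 3} → Proper (gadget b) c → Proper (gadget b') c → b ≡ b'
gadget-determined {true}  {true}  _ _ = refl
gadget-determined {false} {false} _ _ = refl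
gadget-determined {true}  {false} P Q = ⊥-elim (¬proper-for-both-gadgets P Q)
gadget-determined {false} {true}  P Q = ⊥-elim (¬proper-for-both-gadgets Q P)

-- Block i occupies vertices 4i … 4i+3; the vertices from 4m on are isolated.
blocks : ∀ {m n} → Vec Bool m → m * 4 ≤ n → Graph n
blocks []      _                          = emptyGraph
blocks (b ∷ w) (s≤s (s≤s (s≤s (s≤s le)))) = gadget b ⊕ blocks w le

blocks-symmetric : ∀ {m n} (w : Vec Bool m) (le : m * 4 ≤ n) → Symmetric (blocks w le)
blocks-symmetric []      _                          _ _ = refl
blocks-symmetric (b ∷ w) (s≤s (s≤s (s≤s (s≤s le)))) =
  ⊕-symmetric (gadget-symmetric b) (blocks-symmetric w le)

blocks-irreflexive : ∀ {m n} (w : Vec Bool m) (le : m * 4 ≤ n) → Irreflexive (blocks w le)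
blocks-irreflexive []      _                          _ = refl
blocks-irreflexive (b ∷ w) (s≤s (s≤s (s≤s (s≤s le)))) =
  ⊕-irreflexive (gadget-irreflexive b) (blocks-irreflexive w le)

blocks-maxDegree : ∀ {m n} (w : Vec Bool m) (le : m * 4 ≤ n) → MaxDegreeAtMost 2 (blocks w le)
blocks-maxDegree {n = n} [] _ _ rewrite countFin-false n = z≤n
blocks-maxDegree (b ∷ w) (s≤s (s≤s (s≤s (s≤s le)))) =
  ⊕-maxDegree (gadget-maxDegree b) (blocks-maxDegree w le)

blocks-valid : ∀ {m n} (w : Vec Bool m) (le : m * 4 ≤ n) → ValidInput n 2 emptyGraph (blocks w le)
blocks-valid w le =
  (λ _ _ → refl) , blocks-symmetric w le , (λ _ → refl) , blocks-irreflexive w le ,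
  (λ _ _ → refl) , blocks-maxDegree w le

blocks-determined : ∀ {m n} {C : Fin n → Fin 3} (w w' : Vec Bool m) (le : m * 4 ≤ n) →
  Proper (blocks w le) C → Proper (blocks w' le) C → w ≡ w'
blocks-determined []      []        _                          _ _ = refl
blocks-determined (b ∷ w) (b' ∷ w') (s≤s (s≤s (s≤s (s≤s le)))) P P' = cong₂ _∷_
  (gadget-determined (⊕-properˡ P) (⊕-properˡ P'))
  (blocks-determined w w' le (⊕-properʳ P) (⊕-properʳ P'))

m≤cost : ∀ m {n} p {q r} → m * 4 ≤ n → 2 * p < q → (Π : ColoringProtocol r n 2) →
  ComputesColoringWithError p q Π → m ≤ cost Π
m≤cost m p le 2p<q Π Π-correct =
  2^m<2*2^n⇒m≤n m (cost Π) (subst (2 ^ m <_) (cong (2 *_) (*-identityʳ (2 ^ cost Π))) 2^m<2*2^cost)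
  where
  proper-for-≤1 : ∀ C → countStrings m (λ w → isProper (blocks w le) C) ≤ 1
  proper-for-≤1 C = countStrings-≤1 m _ λ w w' w-ok w'-ok →
    blocks-determined w w' le (isProper⇒Proper _ C w-ok) (isProper⇒Proper _ C w'-ok)
  2^m<2*2^cost : 2 ^ m < 2 * (2 ^ cost Π * 1)
  2^m<2*2^cost = 2^m<2*2^cost*B m (λ _ → emptyGraph) (λ w → blocks w le) (λ w C → isProper (blocks w le) C)
    proper-for-≤1 p 2p<q Π (λ w → Π-correct emptyGraph (blocks w le) (blocks-valid w le))

n≤8*[n/4] : ∀ {n} → 4 ≤ n → n ≤ 8 * (n / 4)
n≤8*[n/4] {n} 4≤n = begin
  n                           ≡⟨ m≡m%n+[m/n]*n n 4 ⟩
  n % 4 + n / 4 * 4           ≤⟨ +-monoˡ-≤ (n / 4 * 4) (<⇒≤ (m%n<n n 4)) ⟩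
  4 + n / 4 * 4               ≤⟨ +-monoˡ-≤ (n / 4 * 4) (*-monoˡ-≤ 4 (m≥n⇒m/n>0 4≤n)) ⟩
  n / 4 * 4 + n / 4 * 4       ≡⟨ *-distribˡ-+ (n / 4) 4 4 ⟨
  n / 4 * 8                   ≡⟨ *-comm (n / 4) 8 ⟩
  8 * (n / 4)                 ∎
  where open ≤-Reasoning

theorem5p1 : ∀ (p q : ℕ) → 2 * p < q → ∃ λ k → ∃ λ N₀ → ∀ n → N₀ ≤ n → ∃ λ Δ → ∀ r (Π : ColoringProtocol r n Δ) → ComputesColoringWithError p q Π → n ≤ k * cost Π
theorem5p1 p q 2p<q = 8 , 4 , λ n 4≤n → 2 , λ r Π Π-correct →
  ≤-trans (n≤8*[n/4] 4≤n) (*-monoʳ-≤ 8 (m≤cost (n / 4) p (m/n*n≤m n 4) 2p<q Π Π-correct))
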